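{- For every $\varepsilon>0$ and every positive integer $k$ there exists $\xi>0$ with the following property. Let $G$ be a $k$-partite graph with nonempty vertex classes $V_1,\dots,V_k$ such that $G[V_r,V_{r+1}]$ (with ordered bipartition $(V_r,V_{r+1})$) is $\xi$-poor for all $r\in[k-1]$. For $x\in V_1$ let $g(x)$ be the number of $(k-1)$-tuples $(v_2,\dots,v_k)\in V_2\times\dots\times V_k$ such that $xv_2\dots v_k$ is a path in $G$ (i.e., $xv_2\in E(G)$ and $v_iv_{i+1}\in E(G)$ for $2\le i<k$). Then \[\sum_{x\in V_1}g(x)^2<\Bigl(\frac{1}{2^{k-1}}+\varepsilon\Bigr)^2|V_1|\prod_{i=2}^k|V_i|^2.\]
   Context: For a bipartite graph $G$ with ordered bipartition $(X,Y)$ and $y\in Y$, the number of two-edge walks starting at $y$ is $\sum_{x\in N(y)}\deg(x)$ (walks $yxy'$ with $xy,xy'\in E(G)$, allowing $y'=y$). $G$ is $\xi$-poor if there are at most $\xi|Y|$ vertices $y\in Y$ for which the number of two-edge walks starting at $y$ is larger than $(\frac14+\xi)|X||Y|$.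
   Formalization: The parameter ε ranges over the positive rationals, and the ξ it provides is taken in the rationals as well. -}

module Defs where

open import Data.Bool using (Bool; true; false; if_then_else_)
open import Data.Nat using (ℕ; zero; suc; _+_; _*_)
open import Data.Fin using (Fin; zero; suc; inject₁)
open import Data.Product using (Σ; _,_)
open import Data.Integer using (+_)
open import Data.Rational using (ℚ; _/_; _<_; _≤_; 1ℚ; ½)
import Data.Rational as ℚ
open import Data.Rational.Properties using (_<?_)
open import Relation.Nullary using (does)
open import Relation.Binary.PropositionalEquality using (_≡_)

toℚ : ℕ → ℚ
toℚ n = + n / 1

halfPow : ℕ → ℚ
halfPow zero    = 1ℚ
halfPow (suc m) = ½ ℚ.* halfPow m

sumFin : (n : ℕ) → (Fin n → ℕ) → ℕ
sumFin zero    f = 0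
sumFin (suc n) f = f zero + sumFin n (λ i → f (suc i))

[_] : Bool → ℕ
[ b ] = if b then 1 else 0

countFin : (n : ℕ) → (Fin n → Bool) → ℕ
countFin n P = sumFin n (λ i → [ P i ])

-- Bipartite graphs with ordered bipartition (X , Y), |X| = m, |Y| = n.

record BipartiteGraph : Set where
  field
    m   : ℕ
    n   : ℕ
    adj : Fin m → Fin n → Bool

module _ (G : BipartiteGraph) where
  open BipartiteGraph G

  degX : Fin m → ℕ
  degX x = countFin n (λ y → adj x y)

  twoWalks : Fin n → ℕ
  twoWalks y = sumFin m (λ x → [ adj x y ] * degX x)

  heavy : ℚ → Fin n → Bool
  heavy ξ y = does (((½ ℚ.* ½) ℚ.+ ξ) ℚ.* toℚ m ℚ.* toℚ n <? toℚ (twoWalks y))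

  Poor : ℚ → Set
  Poor ξ = toℚ (countFin n (heavy ξ)) ≤ ξ ℚ.* toℚ n

-- k-partite (simple, finite) graphs with vertex classes V_i = Fin (size i),
-- i ∈ Fin k; vertex set is the disjoint union of the classes.

record KPartiteGraph (k : ℕ) : Set where
  field
    size    : Fin k → ℕ
    adj     : Σ (Fin k) (λ i → Fin (size i)) → Σ (Fin k) (λ i → Fin (size i)) → Bool
    adj-sym : ∀ u v → adj u v ≡ adj v u
    -- no edges inside a vertex class (this also gives irreflexivity)
    adj-class : ∀ i (a b : Fin (size i)) → adj (i , a) (i , b) ≡ false

module _ {m : ℕ} (G : KPartiteGraph (suc m)) where
  open KPartiteGraph G

  -- G[V_{r}, V_{r+1}] with ordered bipartition (V_r , V_{r+1}), r ranging over
  -- the first m classes (0-indexed), i.e. r ∈ [k-1] with k = suc m.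
  consecutive : (r : Fin m) → BipartiteGraph
  consecutive r = record
    { m = size (inject₁ r)
    ; n = size (suc r)
    ; adj = λ a b → adj (inject₁ r , a) (suc r , b)
    }

-- Number of tuples (v_1,…,v_m) ∈ V_1 × … × V_m such that x v_1 … v_m is a
-- path, where x ∈ V_0 and classes V_0,…,V_m; E r a b is adjacency between
-- a ∈ V_r and b ∈ V_{r+1}.
pathCount : (m : ℕ) (size : Fin (suc m) → ℕ)
          → ((r : Fin m) → Fin (size (inject₁ r)) → Fin (size (suc r)) → Bool)
          → Fin (size zero) → ℕ
pathCount zero    size E x = 1
pathCount (suc m) size E x =
  sumFin (size (suc zero))
    (λ w → [ E zero x w ] * pathCount m (λ i → size (suc i)) (λ r → E (suc r)) w)

-- g(x) for x ∈ V_1 (0-indexed class zero) in a k-partite graph, k = suc m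
g : {m : ℕ} (G : KPartiteGraph (suc m)) → Fin (KPartiteGraph.size G zero) → ℕ
g {m} G x = pathCount m size (λ r a b → adj (inject₁ r , a) (suc r , b)) x
  where open KPartiteGraph G

-- Π_{i=2}^{k} |V_i|^2 (classes 1..m, 0-indexed)
prodSqRest : {m : ℕ} (G : KPartiteGraph (suc m)) → ℕ
prodSqRest {m} G = go m (λ i → KPartiteGraph.size G (suc i))
  where
  go : (n : ℕ) → (Fin n → ℕ) → ℕ
  go zero    s = 1
  go (suc n) s = s zero * s zero * go n (λ i → s (suc i))

module Submission where

-- Let h(y) be the number of paths starting at a vertex y of the second class,
-- so that g(x) is the sum of h over the neighbours of x. Cauchy–Schwarz gives
-- Σₓ g(x)² ≤ Σ_y h(y)² w(y), where w(y) counts the two-edge walks from y.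
-- For ξ = 1/N, poorness bounds w(y) by (1/4 + 1/N)|V₁||V₂| outside a set of at
-- most |V₂|/N vertices, and h(y) ≤ |V₃|⋯|V_k| everywhere. Once N ≥ 12 this
-- makes Σ g² ≤ (4^{1-k} + 3/N)|V₁|∏_{i≥2}|Vᵢ|² propagate by induction on k.
-- Finally N ≥ 12 D² with ε ≥ 1/D gives 3/N < ε² ≤ (2^{1-k} + ε)² − 4^{1-k}.

open import Defs

module FiniteSums where
  open import Algebra.Properties.CommutativeSemigroup using (interchange)
  open import Data.Bool using (true; false)
  open import Data.Fin using (Fin; zero; suc)
  open import Data.List using ([]; _∷_)
  open import Data.Nat using (ℕ; zero; suc; _+_; _*_; _≤_; _<_; z≤n)
  open import Data.Nat.Properties
  open import Data.Nat.Tactic.RingSolver using (solve)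
  open import Data.Product using (_,_)
  open import Data.Sum using ([_,_]′)
  open import Function using (_∘_)
  open import Relation.Binary.PropositionalEquality hiding ([_])

  sumFin-cong : ∀ n {f g : Fin n → ℕ} → (∀ i → f i ≡ g i) → sumFin n f ≡ sumFin n g
  sumFin-cong zero    f≗g = refl
  sumFin-cong (suc n) f≗g = cong₂ _+_ (f≗g zero) (sumFin-cong n (f≗g ∘ suc))

  sumFin-mono-≤ : ∀ n {f g : Fin n → ℕ} → (∀ i → f i ≤ g i) → sumFin n f ≤ sumFin n g
  sumFin-mono-≤ zero    f≤g = z≤n
  sumFin-mono-≤ (suc n) f≤g = +-mono-≤ (f≤g zero) (sumFin-mono-≤ n (f≤g ∘ suc))

  sumFin-const : ∀ n c → sumFin n (λ _ → c) ≡ n * c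
  sumFin-const zero    c = refl
  sumFin-const (suc n) c = cong (c +_) (sumFin-const n c)

  sumFin-distrib-+ : ∀ n (f g : Fin n → ℕ) →
                     sumFin n (λ i → f i + g i) ≡ sumFin n f + sumFin n g
  sumFin-distrib-+ zero    f g = refl
  sumFin-distrib-+ (suc n) f g
    rewrite sumFin-distrib-+ n (f ∘ suc) (g ∘ suc) = interchange +-commutativeSemigroup (f zero) (g zero) _ _

  *-distribˡ-sumFin : ∀ n c (f : Fin n → ℕ) → c * sumFin n f ≡ sumFin n (λ i → c * f i)
  *-distribˡ-sumFin zero    c f = *-zeroʳ c
  *-distribˡ-sumFin (suc n) c f =
    trans (*-distribˡ-+ c (f zero) _) (cong (c * f zero +_) (*-distribˡ-sumFin n c (f ∘ suc)))

  *-distribʳ-sumFin : ∀ n c (f : Fin n → ℕ) → sumFin n f * c ≡ sumFin n (λ i → f i * c)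
  *-distribʳ-sumFin n c f = begin
    sumFin n f * c               ≡⟨ *-comm (sumFin n f) c ⟩
    c * sumFin n f               ≡⟨ *-distribˡ-sumFin n c f ⟩
    sumFin n (λ i → c * f i)     ≡⟨ sumFin-cong n (λ i → *-comm c (f i)) ⟩
    sumFin n (λ i → f i * c)     ∎
    where open ≡-Reasoning

  sumFin-comm : ∀ a b (f : Fin a → Fin b → ℕ) →
                sumFin a (λ i → sumFin b (f i)) ≡ sumFin b (λ j → sumFin a (λ i → f i j))
  sumFin-comm zero    b f = sym (trans (sumFin-const b 0) (*-zeroʳ b))
  sumFin-comm (suc a) b f rewrite sumFin-comm a b (f ∘ suc) =
    sym (sumFin-distrib-+ b (f zero) (λ j → sumFin a (λ i → f (suc i) j)))

  sumFin-*-sumFin : ∀ a b (f : Fin a → ℕ) (g : Fin b → ℕ) →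
                    sumFin a f * sumFin b g ≡ sumFin a (λ i → sumFin b (λ j → f i * g j))
  sumFin-*-sumFin a b f g =
    trans (*-distribʳ-sumFin a (sumFin b g) f)
          (sumFin-cong a (λ i → *-distribˡ-sumFin b (f i) g))

  [b]≤1 : ∀ b → [ b ] ≤ 1
  [b]≤1 true  = ≤-refl
  [b]≤1 false = z≤n

  [b]*n≤n : ∀ b n → [ b ] * n ≤ n
  [b]*n≤n true  n = ≤-reflexive (+-identityʳ n)
  [b]*n≤n false n = z≤n

  prodFin : (n : ℕ) → (Fin n → ℕ) → ℕ
  prodFin zero    t = 1
  prodFin (suc n) t = t zero * prodFin n (t ∘ suc)

  prodFin>0 : ∀ n t → (∀ i → 0 < t i) → 0 < prodFin n t
  prodFin>0 zero    t t>0 = ≤-refl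
  prodFin>0 (suc n) t t>0 = *-mono-≤ (t>0 zero) (prodFin>0 n (t ∘ suc) (t>0 ∘ suc))

  prodFin-square : ∀ n t → prodFin n (λ i → t i * t i) ≡ prodFin n t * prodFin n t
  prodFin-square zero    t = refl
  prodFin-square (suc n) t rewrite prodFin-square n (t ∘ suc) =
    lemma (t zero) (prodFin n (t ∘ suc))
    where
    lemma : ∀ a p → a * a * (p * p) ≡ a * p * (a * p)
    lemma a p = solve (a ∷ p ∷ [])

  2*m*n≤m*m+n*n : ∀ m n → 2 * (m * n) ≤ m * m + n * n
  2*m*n≤m*m+n*n m n = [ ordered , swapped ]′ (≤-total m n)
    where
    ordered : ∀ {m n} → m ≤ n → 2 * (m * n) ≤ m * m + n * n
    ordered {m} m≤n with m≤n⇒∃[o]m+o≡n m≤n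
    ... | d , refl = subst (2 * (m * (m + d)) ≤_) (expand m d) (m≤m+n _ (d * d))
      where
      expand : ∀ m d → 2 * (m * (m + d)) + d * d ≡ m * m + (m + d) * (m + d)
      expand m d = solve (m ∷ d ∷ [])
    swapped : n ≤ m → 2 * (m * n) ≤ m * m + n * n
    swapped n≤m = subst₂ _≤_ (cong (2 *_) (*-comm n m)) (+-comm (n * n) (m * m)) (ordered n≤m)

  cauchy-schwarz : ∀ n (w h : Fin n → ℕ) →
                   sumFin n (λ i → w i * h i) * sumFin n (λ i → w i * h i)
                     ≤ sumFin n w * sumFin n (λ i → w i * (h i * h i))
  cauchy-schwarz n w h = *-cancelˡ-≤ 2 (begin
    2 * (X * X)                                      ≡⟨ cong (2 *_) (sumFin-*-sumFin n n wh wh) ⟩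
    2 * sumFin n (λ i → sumFin n (λ j → wh i * wh j)) ≡⟨ double-*-distribˡ ⟩
    sumFin n (λ i → sumFin n (λ j → 2 * (wh i * wh j)))
      ≤⟨ sumFin-mono-≤ n (λ i → sumFin-mono-≤ n (λ j → pointwise i j)) ⟩
    sumFin n (λ i → sumFin n (λ j → wq i * w j + w i * wq j))
      ≡⟨ sumFin-cong n (λ i → sumFin-distrib-+ n _ _) ⟩
    sumFin n (λ i → sumFin n (λ j → wq i * w j) + sumFin n (λ j → w i * wq j))
      ≡⟨ sumFin-distrib-+ n _ _ ⟩
    sumFin n (λ i → sumFin n (λ j → wq i * w j)) + sumFin n (λ i → sumFin n (λ j → w i * wq j))
      ≡⟨ cong₂ _+_ (sumFin-*-sumFin n n wq w) (sumFin-*-sumFin n n w wq) ⟨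
    Q * W + W * Q                                    ≡⟨ cong (_+ W * Q) (*-comm Q W) ⟩
    W * Q + W * Q                                    ≡⟨ cong (W * Q +_) (+-identityʳ (W * Q)) ⟨
    2 * (W * Q)                                      ∎)
    where
    open ≤-Reasoning
    wh wq : Fin n → ℕ
    wh i = w i * h i
    wq i = w i * (h i * h i)
    X = sumFin n wh
    W = sumFin n w
    Q = sumFin n wq
    double-*-distribˡ : 2 * sumFin n (λ i → sumFin n (λ j → wh i * wh j))
                      ≡ sumFin n (λ i → sumFin n (λ j → 2 * (wh i * wh j)))
    double-*-distribˡ = trans (*-distribˡ-sumFin n 2 _) (sumFin-cong n (λ i → *-distribˡ-sumFin n 2 _))
    regroup : ∀ a b x y → 2 * (a * x * (b * y)) ≡ a * b * (2 * (x * y))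
    regroup a b x y = solve (a ∷ b ∷ x ∷ y ∷ [])
    expand : ∀ a b x y → a * b * (x * x + y * y) ≡ a * (x * x) * b + a * (b * (y * y))
    expand a b x y = solve (a ∷ b ∷ x ∷ y ∷ [])
    pointwise : ∀ i j → 2 * (wh i * wh j) ≤ wq i * w j + w i * wq j
    pointwise i j = begin
      2 * (wh i * wh j)                     ≡⟨ regroup (w i) (w j) (h i) (h j) ⟩
      w i * w j * (2 * (h i * h j))         ≤⟨ *-monoʳ-≤ (w i * w j) (2*m*n≤m*m+n*n (h i) (h j)) ⟩
      w i * w j * (h i * h i + h j * h j)   ≡⟨ expand (w i) (w j) (h i) (h j) ⟩
      wq i * w j + w i * wq j               ∎

module PathCounting where
  open FiniteSums
  open import Data.Bool using (Bool; true; false)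
  open import Data.Fin using (Fin; zero; suc; inject₁)
  open import Data.List using ([]; _∷_)
  open import Data.Nat using (ℕ; zero; suc; _+_; _*_; _^_; _≤_; z≤n; s≤s; NonZero; >-nonZero)
  open import Data.Nat.Properties
  open import Data.Nat.Tactic.RingSolver using (solve)
  open import Function using (_∘_)
  open import Relation.Binary.PropositionalEquality hiding ([_])

  module _ (B : BipartiteGraph) where
    open BipartiteGraph B

    neighbourSum : (Fin n → ℕ) → Fin m → ℕ
    neighbourSum h x = sumFin n (λ y → [ adj x y ] * h y)

    degX≤n : ∀ x → degX B x ≤ n
    degX≤n x = begin
      degX B x            ≤⟨ sumFin-mono-≤ n (λ y → [b]≤1 (adj x y)) ⟩
      sumFin n (λ _ → 1)  ≡⟨ trans (sumFin-const n 1) (*-identityʳ n) ⟩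
      n                   ∎
      where open ≤-Reasoning

    twoWalks≤m*n : ∀ y → twoWalks B y ≤ m * n
    twoWalks≤m*n y = begin
      twoWalks B y        ≤⟨ sumFin-mono-≤ m (λ x → ≤-trans ([b]*n≤n (adj x y) _) (degX≤n x)) ⟩
      sumFin m (λ _ → n)  ≡⟨ sumFin-const m n ⟩
      m * n               ∎
      where open ≤-Reasoning

    sumFin-neighbourSum²≤ : ∀ h → sumFin m (λ x → neighbourSum h x * neighbourSum h x)
                                ≤ sumFin n (λ y → h y * h y * twoWalks B y)
    sumFin-neighbourSum²≤ h = begin
      sumFin m (λ x → neighbourSum h x * neighbourSum h x)
        ≤⟨ sumFin-mono-≤ m (λ x → cauchy-schwarz n (λ y → [ adj x y ]) h) ⟩
      sumFin m (λ x → degX B x * sumFin n (λ y → [ adj x y ] * (h y * h y)))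
        ≡⟨ sumFin-cong m (λ x → *-distribˡ-sumFin n (degX B x) _) ⟩
      sumFin m (λ x → sumFin n (λ y → degX B x * ([ adj x y ] * (h y * h y))))
        ≡⟨ sumFin-comm m n _ ⟩
      sumFin n (λ y → sumFin m (λ x → degX B x * ([ adj x y ] * (h y * h y))))
        ≡⟨ sumFin-cong n (λ y → sumFin-cong m (λ x → rotate (degX B x) [ adj x y ] (h y * h y))) ⟩
      sumFin n (λ y → sumFin m (λ x → h y * h y * ([ adj x y ] * degX B x)))
        ≡⟨ sumFin-cong n (λ y → *-distribˡ-sumFin m (h y * h y) _) ⟨
      sumFin n (λ y → h y * h y * twoWalks B y) ∎
      where
      open ≤-Reasoning
      rotate : ∀ d e q → d * (e * q) ≡ q * (e * d)
      rotate d e q = solve (d ∷ e ∷ q ∷ [])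

  -- ξ-poor with ξ = 1/N, multiplied out so that it only involves natural numbers.
  record Poorᴺ (N : ℕ) (B : BipartiteGraph) : Set where
    open BipartiteGraph B
    field
      heavy?      : Fin n → Bool
      few-heavy   : N * countFin n heavy? ≤ n
      light-bound : ∀ y → heavy? y ≡ false → 4 * N * twoWalks B y ≤ (N + 4) * m * n

  module _ {N : ℕ} {B : BipartiteGraph} (poor : Poorᴺ N B) where
    open BipartiteGraph B
    open Poorᴺ poor

    weighted-twoWalks-≤ : ∀ (q : Fin n → ℕ) → 4 * N * sumFin n (λ y → q y * twoWalks B y)
                              ≤ (N + 4) * m * n * sumFin n q
                                + 4 * N * m * n * sumFin n (λ y → [ heavy? y ] * q y)
    weighted-twoWalks-≤ q = begin
      4 * N * sumFin n (λ y → q y * twoWalks B y)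
        ≡⟨ *-distribˡ-sumFin n (4 * N) _ ⟩
      sumFin n (λ y → 4 * N * (q y * twoWalks B y))
        ≤⟨ sumFin-mono-≤ n (λ y → pointwise y (heavy? y) refl) ⟩
      sumFin n (λ y → (N + 4) * m * n * q y + 4 * N * m * n * ([ heavy? y ] * q y))
        ≡⟨ sumFin-distrib-+ n _ _ ⟩
      sumFin n (λ y → (N + 4) * m * n * q y) + sumFin n (λ y → 4 * N * m * n * ([ heavy? y ] * q y))
        ≡⟨ cong₂ _+_ (*-distribˡ-sumFin n ((N + 4) * m * n) q) (*-distribˡ-sumFin n (4 * N * m * n) _) ⟨
      (N + 4) * m * n * sumFin n q + 4 * N * m * n * sumFin n (λ y → [ heavy? y ] * q y) ∎
      where
      open ≤-Reasoning
      pointwise : ∀ y b → heavy? y ≡ b →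
                  4 * N * (q y * twoWalks B y) ≤ (N + 4) * m * n * q y + 4 * N * m * n * ([ b ] * q y)
      pointwise y false light = begin
        4 * N * (q y * twoWalks B y)  ≡⟨ *-comm (4 * N) _ ⟩
        q y * twoWalks B y * (4 * N)  ≡⟨ *-assoc (q y) _ _ ⟩
        q y * (twoWalks B y * (4 * N)) ≡⟨ cong (q y *_) (*-comm _ (4 * N)) ⟩
        q y * (4 * N * twoWalks B y)  ≤⟨ *-monoʳ-≤ (q y) (light-bound y light) ⟩
        q y * ((N + 4) * m * n)       ≡⟨ *-comm (q y) _ ⟩
        (N + 4) * m * n * q y         ≤⟨ m≤m+n _ _ ⟩
        (N + 4) * m * n * q y + 4 * N * m * n * 0 ∎
      pointwise y true _ = begin
        4 * N * (q y * twoWalks B y)  ≤⟨ *-monoʳ-≤ (4 * N) (*-monoʳ-≤ (q y) (twoWalks≤m*n B y)) ⟩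
        4 * N * (q y * (m * n))       ≡⟨ regroup (4 * N) (q y) m n ⟩
        4 * N * m * n * (1 * q y)     ≤⟨ m≤n+m _ _ ⟩
        (N + 4) * m * n * q y + 4 * N * m * n * (1 * q y) ∎
        where
        regroup : ∀ c q a b → c * (q * (a * b)) ≡ c * a * b * (1 * q)
        regroup c q a b = solve (c ∷ q ∷ a ∷ b ∷ [])

    heavy-mass-≤ : ∀ (q : Fin n → ℕ) c → (∀ y → q y ≤ c) → N * sumFin n (λ y → [ heavy? y ] * q y) ≤ n * c
    heavy-mass-≤ q c q≤c = begin
      N * sumFin n (λ y → [ heavy? y ] * q y) ≤⟨ *-monoʳ-≤ N (sumFin-mono-≤ n (λ y → *-monoʳ-≤ [ heavy? y ] (q≤c y))) ⟩
      N * sumFin n (λ y → [ heavy? y ] * c)   ≡⟨ cong (N *_) (*-distribʳ-sumFin n c _) ⟨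
      N * (countFin n heavy? * c)             ≡⟨ *-assoc N _ c ⟨
      N * countFin n heavy? * c               ≤⟨ *-monoˡ-≤ c few-heavy ⟩
      n * c                                   ∎
      where open ≤-Reasoning

  Layers : (m : ℕ) → (Fin (suc m) → ℕ) → Set
  Layers m s = (r : Fin m) → Fin (s (inject₁ r)) → Fin (s (suc r)) → Bool

  layer : ∀ {m} (s : Fin (suc m) → ℕ) → Layers m s → Fin m → BipartiteGraph
  layer s E r = record { m = s (inject₁ r) ; n = s (suc r) ; adj = E r }

  pathCount≤prodFin : ∀ m s (E : Layers m s) x → pathCount m s E x ≤ prodFin m (s ∘ suc)
  pathCount≤prodFin zero    s E x = ≤-refl
  pathCount≤prodFin (suc m) s E x = begin
    pathCount (suc m) s E x
      ≤⟨ sumFin-mono-≤ (s (suc zero)) (λ w → ≤-trans ([b]*n≤n (E zero x w) _)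
                                                (pathCount≤prodFin m (s ∘ suc) (E ∘ suc) w)) ⟩
    sumFin (s (suc zero)) (λ _ → prodFin m (λ i → s (suc (suc i))))
      ≡⟨ sumFin-const (s (suc zero)) _ ⟩
    prodFin (suc m) (s ∘ suc) ∎
    where open ≤-Reasoning

  -- The numerical heart of the induction: the constant 1/K + 3/N
  -- (K = 4^m) is mapped to at most 1/(4K) + 3/N as long as N ≥ 12.
  recurrence-step : ∀ {N K a b Q X S H} → 12 ≤ N → 1 ≤ K →
                    4 * N * X ≤ (N + 4) * a * b * S + 4 * N * a * b * H →
                    K * N * S ≤ (N + 3 * K) * (b * Q) →
                    N * H ≤ b * Q →
                    4 * K * N * X ≤ (N + 3 * (4 * K)) * (a * (b * b * Q))
  recurrence-step {N} {K} {a} {b} {Q} {X} {S} {H} 12≤N 1≤K step IH heavy =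
    *-cancelˡ-≤ N {{nonZero}} (begin
      N * (4 * K * N * X)                                   ≡⟨ solve (N ∷ K ∷ X ∷ []) ⟩
      K * N * (4 * N * X)                                   ≤⟨ *-monoʳ-≤ (K * N) step ⟩
      K * N * ((N + 4) * a * b * S + 4 * N * a * b * H)     ≡⟨ solve (N ∷ K ∷ a ∷ b ∷ S ∷ H ∷ []) ⟩
      (N + 4) * a * b * (K * N * S) + 4 * K * N * a * b * (N * H)
        ≤⟨ +-mono-≤ (*-monoʳ-≤ ((N + 4) * a * b) IH) (*-monoʳ-≤ (4 * K * N * a * b) heavy) ⟩
      (N + 4) * a * b * ((N + 3 * K) * (b * Q)) + 4 * K * N * a * b * (b * Q)  ≡⟨ solve (N ∷ K ∷ a ∷ b ∷ Q ∷ []) ⟩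
      ((N + 4) * (N + 3 * K) + 4 * K * N) * (a * (b * b * Q))
        ≤⟨ *-monoˡ-≤ (a * (b * b * Q)) coefficient ⟩
      N * (N + 3 * (4 * K)) * (a * (b * b * Q))            ≡⟨ *-assoc N _ _ ⟩
      N * ((N + 3 * (4 * K)) * (a * (b * b * Q)))          ∎)
    where
    open ≤-Reasoning
    nonZero : NonZero N
    nonZero = >-nonZero (≤-trans (s≤s z≤n) 12≤N)
    coefficient : (N + 4) * (N + 3 * K) + 4 * K * N ≤ N * (N + 3 * (4 * K))
    coefficient = begin
      (N + 4) * (N + 3 * K) + 4 * K * N       ≡⟨ solve (N ∷ K ∷ []) ⟩
      N * N + 7 * (K * N) + (4 * N + 12 * K)  ≤⟨ +-monoʳ-≤ (N * N + 7 * (K * N))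
                                                   (+-mono-≤ (*-monoʳ-≤ 4 (m≤n*m N K {{>-nonZero 1≤K}}))
                                                             (*-monoˡ-≤ K 12≤N)) ⟩
      N * N + 7 * (K * N) + (4 * (K * N) + N * K) ≡⟨ solve (N ∷ K ∷ []) ⟩
      N * (N + 3 * (4 * K))                   ∎

  module _ {N : ℕ} (12≤N : 12 ≤ N) where

    pathCount-square-sum-≤ :
      ∀ m s (E : Layers m s) → (∀ r → Poorᴺ N (layer s E r)) →
      4 ^ m * N * sumFin (s zero) (λ x → pathCount m s E x * pathCount m s E x)
        ≤ (N + 3 * 4 ^ m) * (s zero * prodFin m (λ i → s (suc i) * s (suc i)))
    pathCount-square-sum-≤ zero s E _ = begin
      1 * N * sumFin (s zero) (λ _ → 1)  ≡⟨ cong₂ _*_ (*-identityˡ N) (sumFin-const (s zero) 1) ⟩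
      N * (s zero * 1)                   ≤⟨ *-monoˡ-≤ (s zero * 1) (m≤m+n N (3 * 1)) ⟩
      (N + 3 * 1) * (s zero * 1)         ∎
      where open ≤-Reasoning
    pathCount-square-sum-≤ (suc m) s E poor =
      recurrence-step 12≤N (m^n>0 4 m) first-layer rest heavy-part
      where
      open ≤-Reasoning
      B = layer s E zero
      b = s (suc zero)
      h : Fin b → ℕ
      h = pathCount m (s ∘ suc) (E ∘ suc)
      P = prodFin m (λ i → s (suc (suc i)))
      first-layer : 4 * N * sumFin (s zero) (λ x → neighbourSum B h x * neighbourSum B h x)
                    ≤ (N + 4) * s zero * b * sumFin b (λ y → h y * h y)
                      + 4 * N * s zero * b * sumFin b (λ y → [ Poorᴺ.heavy? (poor zero) y ] * (h y * h y))
      first-layer = ≤-trans (*-monoʳ-≤ (4 * N) (sumFin-neighbourSum²≤ B h))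
                            (weighted-twoWalks-≤ (poor zero) (λ y → h y * h y))
      rest : 4 ^ m * N * sumFin b (λ y → h y * h y) ≤ (N + 3 * 4 ^ m) * (b * prodFin m (λ i → s (suc (suc i)) * s (suc (suc i))))
      rest = pathCount-square-sum-≤ m (s ∘ suc) (E ∘ suc) (poor ∘ suc)
      heavy-part : N * sumFin b (λ y → [ Poorᴺ.heavy? (poor zero) y ] * (h y * h y))
                   ≤ b * prodFin m (λ i → s (suc (suc i)) * s (suc (suc i)))
      heavy-part = begin
        N * sumFin b (λ y → [ Poorᴺ.heavy? (poor zero) y ] * (h y * h y))
          ≤⟨ heavy-mass-≤ (poor zero) (λ y → h y * h y) (P * P)
               (λ y → *-mono-≤ (pathCount≤prodFin m (s ∘ suc) (E ∘ suc) y)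
                               (pathCount≤prodFin m (s ∘ suc) (E ∘ suc) y)) ⟩
        b * (P * P)  ≡⟨ cong (b *_) (prodFin-square m (λ i → s (suc (suc i)))) ⟨
        b * prodFin m (λ i → s (suc (suc i)) * s (suc (suc i))) ∎

module RationalBounds where
  open FiniteSums using (prodFin; prodFin>0)
  open PathCounting using (Poorᴺ; Layers; pathCount-square-sum-≤)
  open import Data.Bool using (false)
  open import Data.Fin using (Fin; zero; suc; inject₁)
  open import Data.Integer as ℤ using (+_; +[1+_])
  import Data.Integer.Properties as ℤ
  open import Data.Nat as ℕ using (ℕ; zero; suc; _^_; z≤n; s≤s)
  import Data.Nat.Properties as ℕ
  open import Data.Nat.Coprimality using (1-coprimeTo) renaming (sym to coprime-sym)
  open import Data.Product using (_,_)
  open import Data.Rational as ℚ using (ℚ; mkℚ; 0ℚ; 1ℚ; ½; _+_; _*_; _≤_; _<_; ↧ₙ_; NonNegative; Positive)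
  open import Data.Rational.Properties as ℚ using (+-*-commutativeRing; _≟_; _<?_)
  open import Level using (0ℓ)
  open import Relation.Binary.PropositionalEquality hiding ([_])
  open import Relation.Nullary using (¬_; proof)
  open import Relation.Nullary.Decidable using (dec⇒maybe)
  open import Relation.Nullary.Reflects using (Reflects; invert)
  import Tactic.RingSolver
  import Tactic.RingSolver.Core.AlmostCommutativeRing as ACR

  ℚ-ring : ACR.AlmostCommutativeRing 0ℓ 0ℓ
  ℚ-ring = ACR.fromCommutativeRing +-*-commutativeRing (λ x → dec⇒maybe (0ℚ ≟ x))

  toℚ≡mkℚ : ∀ n → toℚ n ≡ mkℚ (+ n) 0 (coprime-sym (1-coprimeTo n))
  toℚ≡mkℚ n = ℚ.normalize-coprime (coprime-sym (1-coprimeTo n))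

  toℚ-homo-+ : ∀ a b → toℚ (a ℕ.+ b) ≡ toℚ a + toℚ b
  toℚ-homo-+ a b rewrite toℚ≡mkℚ a | toℚ≡mkℚ b =
    cong (ℚ._/ 1) (sym (cong₂ ℤ._+_ (ℤ.*-identityʳ (+ a)) (ℤ.*-identityʳ (+ b))))

  toℚ-homo-* : ∀ a b → toℚ (a ℕ.* b) ≡ toℚ a * toℚ b
  toℚ-homo-* a b rewrite toℚ≡mkℚ a | toℚ≡mkℚ b = cong (ℚ._/ 1) (ℤ.pos-* a b)

  toℚ-mono-≤ : ∀ {a b} → a ℕ.≤ b → toℚ a ≤ toℚ b
  toℚ-mono-≤ {a} {b} a≤b rewrite toℚ≡mkℚ a | toℚ≡mkℚ b =
    ℚ.*≤* (subst₂ ℤ._≤_ (sym (ℤ.*-identityʳ (+ a))) (sym (ℤ.*-identityʳ (+ b))) (ℤ.+≤+ a≤b))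

  toℚ-mono-< : ∀ {a b} → a ℕ.< b → toℚ a < toℚ b
  toℚ-mono-< {a} {b} a<b rewrite toℚ≡mkℚ a | toℚ≡mkℚ b =
    ℚ.*<* (subst₂ ℤ._<_ (sym (ℤ.*-identityʳ (+ a))) (sym (ℤ.*-identityʳ (+ b))) (ℤ.+<+ a<b))

  toℚ-cancel-≤ : ∀ {a b} → toℚ a ≤ toℚ b → a ℕ.≤ b
  toℚ-cancel-≤ {a} {b} le rewrite toℚ≡mkℚ a | toℚ≡mkℚ b with le
  ... | ℚ.*≤* p = ℤ.drop‿+≤+ (subst₂ ℤ._≤_ (ℤ.*-identityʳ (+ a)) (ℤ.*-identityʳ (+ b)) p)

  toℚ-nonNeg : ∀ n → NonNegative (toℚ n)
  toℚ-nonNeg n = ℚ.normalize-nonNeg n 1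

  1/suc : ℕ → ℚ
  1/suc n = mkℚ (+ 1) n (1-coprimeTo (suc n))

  1/suc*toℚ : ∀ n → 1/suc n * toℚ (suc n) ≡ 1ℚ
  1/suc*toℚ n rewrite toℚ≡mkℚ (suc n) = ℚ.*-inverseˡ (mkℚ (+ suc n) 0 (coprime-sym (1-coprimeTo (suc n))))

  module _ {k : ℕ} (B : BipartiteGraph) (poor : Poor B (1/suc k)) where
    open BipartiteGraph B renaming (m to a; n to b)
    open ℚ.≤-Reasoning

    private
      N : ℕ
      N = suc k
      ξ : ℚ
      ξ = 1/suc k
      ξN≡1 : ξ * toℚ N ≡ 1ℚ
      ξN≡1 = 1/suc*toℚ k

      scale : ∀ x y z → z * (x * y) ≡ x * z * y
      scale = Tactic.RingSolver.solve-∀ ℚ-ring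

    poor-few-heavy : N ℕ.* countFin b (heavy B ξ) ℕ.≤ b
    poor-few-heavy = toℚ-cancel-≤ (begin
      toℚ (N ℕ.* c)         ≡⟨ toℚ-homo-* N c ⟩
      toℚ N * toℚ c         ≤⟨ ℚ.*-monoˡ-≤-nonNeg (toℚ N) {{toℚ-nonNeg N}} poor ⟩
      toℚ N * (ξ * toℚ b)   ≡⟨ scale ξ (toℚ b) (toℚ N) ⟩
      ξ * toℚ N * toℚ b     ≡⟨ cong (_* toℚ b) ξN≡1 ⟩
      1ℚ * toℚ b            ≡⟨ ℚ.*-identityˡ (toℚ b) ⟩
      toℚ b                 ∎)
      where c = countFin b (heavy B ξ)

    poor-light : ∀ y → heavy B ξ y ≡ false → 4 ℕ.* N ℕ.* twoWalks B y ℕ.≤ (N ℕ.+ 4) ℕ.* a ℕ.* b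
    poor-light y light = toℚ-cancel-≤ (begin
      toℚ (4 ℕ.* N ℕ.* t)                 ≡⟨ trans (toℚ-homo-* (4 ℕ.* N) t) (cong (_* toℚ t) (toℚ-homo-* 4 N)) ⟩
      toℚ 4 * toℚ N * toℚ t               ≤⟨ ℚ.*-monoˡ-≤-nonNeg (toℚ 4 * toℚ N) {{ℚ.nonNeg*nonNeg⇒nonNeg (toℚ 4) (toℚ N) {{toℚ-nonNeg N}}}}
                                               (ℚ.≮⇒≥ not-heavy) ⟩
      toℚ 4 * toℚ N * ((½ * ½ + ξ) * toℚ a * toℚ b)  ≡⟨ quarter (toℚ N) ξ (toℚ a) (toℚ b) ⟩
      (toℚ N + toℚ 4 * (ξ * toℚ N)) * toℚ a * toℚ b   ≡⟨ cong (λ z → (toℚ N + toℚ 4 * z) * toℚ a * toℚ b) ξN≡1 ⟩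
      (toℚ N + toℚ 4 * 1ℚ) * toℚ a * toℚ b             ≡⟨ sym (trans (toℚ-homo-* ((N ℕ.+ 4) ℕ.* a) b)
                                                             (cong (_* toℚ b) (trans (toℚ-homo-* (N ℕ.+ 4) a)
                                                               (cong (_* toℚ a) (toℚ-homo-+ N 4))))) ⟩
      toℚ ((N ℕ.+ 4) ℕ.* a ℕ.* b)          ∎)
      where
      t = twoWalks B y
      threshold : ℚ
      threshold = (½ * ½ + ξ) * toℚ a * toℚ b
      not-heavy : ¬ (threshold < toℚ t)
      not-heavy = invert (subst (Reflects (threshold < toℚ t)) light (proof (threshold <? toℚ t)))
      quarter : ∀ n x p q → toℚ 4 * n * ((½ * ½ + x) * p * q) ≡ (n + toℚ 4 * (x * n)) * p * q
      quarter = Tactic.RingSolver.solve-∀ ℚ-ring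

    poor⇒Poorᴺ : Poorᴺ N B
    poor⇒Poorᴺ = record { heavy? = heavy B ξ ; few-heavy = poor-few-heavy ; light-bound = poor-light }

  halfPow-nonNeg : ∀ m → NonNegative (halfPow m)
  halfPow-nonNeg zero    = _
  halfPow-nonNeg (suc m) = ℚ.nonNeg*nonNeg⇒nonNeg ½ (halfPow m) {{halfPow-nonNeg m}}

  halfPow²*4^ : ∀ m → halfPow m * halfPow m * toℚ (4 ^ m) ≡ 1ℚ
  halfPow²*4^ zero    = refl
  halfPow²*4^ (suc m) = begin
    ½ * h * (½ * h) * toℚ (4 ℕ.* 4 ^ m)   ≡⟨ cong (½ * h * (½ * h) *_) (toℚ-homo-* 4 (4 ^ m)) ⟩
    ½ * h * (½ * h) * (toℚ 4 * toℚ (4 ^ m)) ≡⟨ halve h (toℚ (4 ^ m)) ⟩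
    h * h * toℚ (4 ^ m)                    ≡⟨ halfPow²*4^ m ⟩
    1ℚ                                     ∎
    where
    open ≡-Reasoning
    h = halfPow m
    halve : ∀ x y → ½ * x * (½ * x) * (toℚ 4 * y) ≡ x * x * y
    halve = Tactic.RingSolver.solve-∀ ℚ-ring

  1≤*denominator : ∀ ε → Positive ε → 1ℚ ≤ ε * toℚ (↧ₙ ε)
  1≤*denominator ε@(mkℚ +[1+ p ] d _) _ = begin
    1ℚ                   ≡⟨ 1/suc*toℚ d ⟨
    1/suc d * toℚ (suc d) ≤⟨ ℚ.*-monoʳ-≤-nonNeg (toℚ (suc d)) {{toℚ-nonNeg (suc d)}} 1/suc≤ε ⟩
    ε * toℚ (suc d)       ∎
    where
    open ℚ.≤-Reasoning
    1/suc≤ε : 1/suc d ≤ ε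
    1/suc≤ε = ℚ.*≤* (ℤ.*-monoʳ-≤-nonNeg +[1+ d ] (ℤ.+≤+ (s≤s (z≤n {p}))))

  three<ε²N : ∀ ε D {N} → 0ℚ ≤ ε → 1ℚ ≤ ε * toℚ D → 12 ℕ.* (D ℕ.* D) ℕ.≤ N → toℚ 3 < ε * ε * toℚ N
  three<ε²N ε D {N} 0≤ε 1≤εD 12D²≤N = begin-strict
    toℚ 3                          <⟨ toℚ-mono-< {3} {12} (ℕ.m≤m+n 4 8) ⟩
    toℚ 12 * 1ℚ                    ≤⟨ ℚ.*-monoˡ-≤-nonNeg (toℚ 12) {{toℚ-nonNeg 12}} 1≤x*x ⟩
    toℚ 12 * (x * x)               ≡⟨ regroup ε (toℚ D) ⟩
    ε * ε * (toℚ 12 * (toℚ D * toℚ D)) ≡⟨ cong (ε * ε *_) (trans (toℚ-homo-* 12 (D ℕ.* D)) (cong (toℚ 12 *_) (toℚ-homo-* D D))) ⟨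
    ε * ε * toℚ (12 ℕ.* (D ℕ.* D))  ≤⟨ ℚ.*-monoˡ-≤-nonNeg (ε * ε) {{ℚ.nonNeg*nonNeg⇒nonNeg ε ε}} (toℚ-mono-≤ 12D²≤N) ⟩
    ε * ε * toℚ N                  ∎
    where
    open ℚ.≤-Reasoning
    instance
      ε-nonNeg : NonNegative ε
      ε-nonNeg = ℚ.nonNegative 0≤ε
    x = ε * toℚ D
    1≤x*x : 1ℚ ≤ x * x
    1≤x*x = ℚ.≤-trans (ℚ.*-monoʳ-≤-nonNeg 1ℚ 1≤εD)
                      (ℚ.*-monoˡ-≤-nonNeg x {{ℚ.nonNegative (ℚ.≤-trans (ℚ.nonNegative⁻¹ 1ℚ) 1≤εD)}} 1≤εD)
    regroup : ∀ e d → toℚ 12 * (e * d * (e * d)) ≡ e * e * (toℚ 12 * (d * d))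
    regroup = Tactic.RingSolver.solve-∀ ℚ-ring

  module _ {h ε : ℚ} (0≤h : 0ℚ ≤ h) (0≤ε : 0ℚ ≤ ε) where
    open ℚ.≤-Reasoning

    private
      instance
        h-nonNeg : NonNegative h
        h-nonNeg = ℚ.nonNegative 0≤h
        ε-nonNeg : NonNegative ε
        ε-nonNeg = ℚ.nonNegative 0≤ε

    square-gap : ∀ {k n} → Positive k → NonNegative n → h * h * k ≡ 1ℚ → toℚ 3 < ε * ε * n →
                 n + toℚ 3 * k < (h + ε) * (h + ε) * (k * n)
    square-gap {k} {n} k>0 n≥0 h²k≡1 3<ε²n = begin-strict
      n + toℚ 3 * k                               <⟨ ℚ.+-monoʳ-< n (ℚ.*-monoˡ-<-pos k {{k>0}} 3<ε²n) ⟩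
      n + ε * ε * n * k                           ≡⟨ ℚ.+-identityˡ _ ⟨
      0ℚ + (n + ε * ε * n * k)                    ≤⟨ ℚ.+-monoˡ-≤ (n + ε * ε * n * k) (ℚ.nonNegative⁻¹ cross {{cross≥0}}) ⟩
      cross + (n + ε * ε * n * k)                 ≡⟨ cong (λ z → cross + (z + ε * ε * n * k))
                                                       (trans (sym (ℚ.*-identityˡ n)) (cong (_* n) (sym h²k≡1))) ⟩
      cross + (h * h * k * n + ε * ε * n * k)     ≡⟨ expand h ε k n ⟩
      (h + ε) * (h + ε) * (k * n)                 ∎
      where
      cross = (h * ε + h * ε) * (k * n)
      cross≥0 : NonNegative cross
      cross≥0 = ℚ.nonNeg*nonNeg⇒nonNeg (h * ε + h * ε) {{2hε≥0}} (k * n) {{kn≥0}}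
        where
        hε≥0 : NonNegative (h * ε)
        hε≥0 = ℚ.nonNeg*nonNeg⇒nonNeg h ε
        2hε≥0 : NonNegative (h * ε + h * ε)
        2hε≥0 = ℚ.nonNeg+nonNeg⇒nonNeg (h * ε) {{hε≥0}} (h * ε) {{hε≥0}}
        kn≥0 : NonNegative (k * n)
        kn≥0 = ℚ.nonNeg*nonNeg⇒nonNeg k {{ℚ.pos⇒nonNeg k {{k>0}}}} n {{n≥0}}
      expand : ∀ a b c d → (a * b + a * b) * (c * d) + (a * a * c * d + b * b * d * c) ≡ (a + b) * (a + b) * (c * d)
      expand = Tactic.RingSolver.solve-∀ ℚ-ring

    final-bound : ∀ {K N S T} → 1 ℕ.≤ K → 1 ℕ.≤ T → h * h * toℚ K ≡ 1ℚ → toℚ 3 < ε * ε * toℚ N →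
                  K ℕ.* N ℕ.* S ℕ.≤ (N ℕ.+ 3 ℕ.* K) ℕ.* T → toℚ S < (h + ε) * (h + ε) * toℚ T
    final-bound {K} {N} {S} {T} 1≤K 1≤T h²K≡1 3<ε²N bound =
      ℚ.*-cancelʳ-<-nonNeg (k * n) {{ℚ.nonNeg*nonNeg⇒nonNeg k {{toℚ-nonNeg K}} n {{toℚ-nonNeg N}}}} (begin-strict
        s * (k * n)                     ≡⟨ ℚ.*-comm s (k * n) ⟩
        k * n * s                       ≡⟨ trans (toℚ-homo-* (K ℕ.* N) S) (cong (_* s) (toℚ-homo-* K N)) ⟨
        toℚ (K ℕ.* N ℕ.* S)             ≤⟨ toℚ-mono-≤ bound ⟩
        toℚ ((N ℕ.+ 3 ℕ.* K) ℕ.* T)     ≡⟨ trans (toℚ-homo-* (N ℕ.+ 3 ℕ.* K) T)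
                                             (cong (_* t) (trans (toℚ-homo-+ N (3 ℕ.* K)) (cong (λ z → n + z) (toℚ-homo-* 3 K)))) ⟩
        (n + toℚ 3 * k) * t             <⟨ ℚ.*-monoˡ-<-pos t {{positive 1≤T}}
                                             (square-gap (positive 1≤K) (toℚ-nonNeg N) h²K≡1 3<ε²N) ⟩
        (h + ε) * (h + ε) * (k * n) * t ≡⟨ swap ((h + ε) * (h + ε)) (k * n) t ⟩
        (h + ε) * (h + ε) * t * (k * n) ∎)
      where
      k = toℚ K
      n = toℚ N
      s = toℚ S
      t = toℚ T
      positive : ∀ {a} → 1 ℕ.≤ a → Positive (toℚ a)
      positive 1≤a = ℚ.positive (toℚ-mono-< 1≤a)
      swap : ∀ x y z → x * y * z ≡ x * z * y
      swap = Tactic.RingSolver.solve-∀ ℚ-ring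

  -- prodSqRest only looks at the class sizes, so the induction may pass to the
  -- edgeless graph on the remaining classes.
  edgeless : ∀ {k} → (Fin k → ℕ) → KPartiteGraph k
  edgeless s = record { size = s ; adj = λ _ _ → false ; adj-sym = λ _ _ → refl ; adj-class = λ _ _ _ → refl }

  prodSqRest≡prodFin : ∀ {m} (G : KPartiteGraph (suc m)) →
                       prodSqRest G ≡ prodFin m (λ i → KPartiteGraph.size G (suc i) ℕ.* KPartiteGraph.size G (suc i))
  prodSqRest≡prodFin {zero}  G = refl
  prodSqRest≡prodFin {suc m} G = cong (s (suc zero) ℕ.* s (suc zero) ℕ.*_) (prodSqRest≡prodFin (edgeless (λ i → s (suc i))))
    where s = KPartiteGraph.size G

  g-square-sum-< :
    ∀ ε D {n m} → 0ℚ < ε → 1ℚ ≤ ε * toℚ D → 12 ℕ.≤ suc n → 12 ℕ.* (D ℕ.* D) ℕ.≤ suc n →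
    (G : KPartiteGraph (suc m)) → (∀ i → 1 ℕ.≤ KPartiteGraph.size G i) →
    (∀ r → Poor (consecutive G r) (1/suc n)) →
    toℚ (sumFin (KPartiteGraph.size G zero) (λ x → g G x ℕ.* g G x))
      < (halfPow m + ε) * (halfPow m + ε) * (toℚ (KPartiteGraph.size G zero) * toℚ (prodSqRest G))
  g-square-sum-< ε D {n} {m} 0<ε 1≤εD 12≤N 12D²≤N G nonempty poor =
    subst (λ z → toℚ S < (halfPow m + ε) * (halfPow m + ε) * z) T≡
      (final-bound (ℚ.nonNegative⁻¹ (halfPow m) {{halfPow-nonNeg m}}) 0≤ε (ℕ.m^n>0 4 m) 1≤T (halfPow²*4^ m)
         (three<ε²N ε D 0≤ε 1≤εD 12D²≤N)
         (pathCount-square-sum-≤ 12≤N m size E (λ r → poor⇒Poorᴺ {n} (consecutive G r) (poor r))))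
    where
    open KPartiteGraph G
    0≤ε : 0ℚ ≤ ε
    0≤ε = ℚ.<⇒≤ 0<ε
    E : Layers m size
    E r a b = adj (inject₁ r , a) (suc r , b)
    S = sumFin (size zero) (λ x → g G x ℕ.* g G x)
    Q = prodFin m (λ i → size (suc i) ℕ.* size (suc i))
    1≤T : 1 ℕ.≤ size zero ℕ.* Q
    1≤T = ℕ.*-mono-≤ (nonempty zero) (prodFin>0 m _ (λ i → ℕ.*-mono-≤ (nonempty (suc i)) (nonempty (suc i))))
    T≡ : toℚ (size zero ℕ.* Q) ≡ toℚ (size zero) * toℚ (prodSqRest G)
    T≡ = trans (toℚ-homo-* (size zero) Q) (cong (λ z → toℚ (size zero) * toℚ z) (sym (prodSqRest≡prodFin G)))

open RationalBounds using (1/suc; 1≤*denominator; g-square-sum-<)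
import Data.Nat as ℕ
import Data.Nat.Properties as ℕ
import Data.Rational as ℚ
import Data.Rational.Properties as ℚ

open import Data.Nat using (ℕ; suc; _≤_)
open import Data.Fin using (Fin; zero)
open import Data.Product using (Σ; _×_; _,_)
open import Data.Rational using (ℚ; 0ℚ; _<_; _+_; _*_)

proposition6p2 : (ε : ℚ) → 0ℚ < ε → (m : ℕ)
    → Σ ℚ (λ ξ → 0ℚ < ξ
        × ((G : KPartiteGraph (suc m))
          → (∀ i → 1 ≤ KPartiteGraph.size G i)
          → (∀ (r : Fin m) → Poor (consecutive G r) ξ)
          → toℚ (sumFin (KPartiteGraph.size G zero) (λ x → g G x Data.Nat.* g G x))
            < ((halfPow m + ε) * (halfPow m + ε))
              * (toℚ (KPartiteGraph.size G zero) * toℚ (prodSqRest G))))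
proposition6p2 ε 0<ε m =
  1/suc n , ℚ.positive⁻¹ (1/suc n) ,
  g-square-sum-< ε D {n} 0<ε (1≤*denominator ε (ℚ.positive 0<ε)) (ℕ.m≤m+n 12 _) (ℕ.m≤n+m _ 12)
  where
  D n : ℕ
  D = ℚ.↧ₙ ε
  n = 11 ℕ.+ 12 ℕ.* (D ℕ.* D)
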